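{- Each of the following intervals $[\mathcal{D}_1,\mathcal{D}_2]=\{\mathcal{K}\in{\bf E}_{\mathbb{B}}:\mathcal{D}_1\subseteq\mathcal{K}\subseteq\mathcal{D}_2\}$ contains uncountably many equational classes: (i) $[\mathcal{C}_1\cap\mathcal{C}_2,\mathcal{C}_2]$ for $\mathcal{C}_1\in\{T_c,M\}$ and $\mathcal{C}_2\in\{U_m:m\ge2\}\cup\{U_\infty\}$; (ii) $[\mathcal{C}_1\cap\mathcal{C}_2,\mathcal{C}_2]$ for $\mathcal{C}_1\in\{T_c,M\}$ and $\mathcal{C}_2\in\{W_m:m\ge2\}\cup\{W_\infty\}$; (iii) $[M_c\cap\mathcal{C}_2,\mathcal{C}_2]$ for $\mathcal{C}_2\in\{T_c\cap U_m:m\ge2\}\cup\{T_c\cap U_\infty\}$; (iv) $[M_c\cap\mathcal{C}_2,\mathcal{C}_2]$ for $\mathcal{C}_2\in\{T_c\cap W_m:m\ge2\}\cup\{T_c\cap W_\infty\}$.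
   Context: Boolean functions are maps $\{0,1\}^n\to\{0,1\}$, $n\ge1$. An equational class is a set of Boolean functions closed under $f\mapsto f(p_1,\dots,p_n)$ for projections $p_i$; ${\bf E}_{\mathbb{B}}$ is the set of them. $T_c=\{f:f(0,\dots,0)=0,\ f(1,\dots,1)=1\}$; $M$ = monotone functions (componentwise order); $M_c=M\cap T_c$. For $a\in\{0,1\}$, $B\subseteq\{0,1\}^n$ is $a$-separating if some coordinate $i$ has $b_i=a$ for all $b\in B$; $f$ is $a$-separating of rank $k\ge2$ if every subset of $f^{ -1}(a)$ of size at most $k$ is $a$-separating. $U_m$ ($W_m$), $m\ge2$: $1$-separating ($0$-separating) functions of rank $m$; $U_\infty=\bigcap_{k\ge2}U_k$, $W_\infty=\bigcap_{k\ge2}W_k$. -}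

module Defs where

open import Data.Nat using (ℕ; suc; _≤_)
open import Data.Fin using (Fin)
open import Data.Bool using (Bool; true; false) renaming (_≤_ to _≤ᵇ_)
open import Data.List using (List; length)
open import Data.List.Relation.Unary.All using (All)
open import Data.Product using (Σ; ∃; _×_; _,_)
open import Data.Empty using (⊥)
open import Function using (_∘_; const)
open import Relation.Nullary using (¬_)
open import Relation.Binary.PropositionalEquality using (_≡_)

-- A Boolean function {0,1}^n → {0,1} with n ≥ 1 is encoded as a pair
-- (k , f) with n = suc k and f : (Fin (suc k) → Bool) → Bool.
Tuple : ℕ → Set
Tuple k = Fin (suc k) → Bool

BFun : Set
BFun = Σ ℕ (λ k → Tuple k → Bool)

Class : Set₁
Class = BFun → Set

_⊆_ : Class → Class → Set
K ⊆ L = ∀ f → K f → L f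

_∩_ : Class → Class → Class
(K ∩ L) f = K f × L f

_≐_ : Class → Class → Set
K ≐ L = K ⊆ L × L ⊆ K

-- A class is a set of *functions*: it respects pointwise equality.
Extensional : Class → Set
Extensional K = ∀ k (f g : Tuple k → Bool) → (∀ x → f x ≡ g x) → K (k , f) → K (k , g)

minor : ∀ {k m} → (Tuple k → Bool) → (Fin (suc k) → Fin (suc m)) → Tuple m → Bool
minor f σ x = f (x ∘ σ)

IsEquationalClass : Class → Set
IsEquationalClass K =
  Extensional K ×
  (∀ k m (f : Tuple k → Bool) (σ : Fin (suc k) → Fin (suc m)) → K (k , f) → K (m , minor f σ))

Tc : Class
Tc (k , f) = f (const false) ≡ false × f (const true) ≡ true

_≤ₜ_ : ∀ {k} → Tuple k → Tuple k → Set
x ≤ₜ y = ∀ i → x i ≤ᵇ y i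

Mon : Class
Mon (k , f) = ∀ x y → x ≤ₜ y → f x ≤ᵇ f y

Mc : Class
Mc = Mon ∩ Tc

-- a-separating set (finite sets given as lists; a list of length ≤ r
-- covers exactly the subsets of size ≤ r, duplicates being harmless)
Separating : ∀ {k} → Bool → List (Tuple k) → Set
Separating {k} a B = ∃ λ (i : Fin (suc k)) → All (λ b → b i ≡ a) B

SepRank : Bool → ℕ → Class
SepRank a r (k , f) =
  ∀ (B : List (Tuple k)) → length B ≤ r → All (λ b → f b ≡ a) B → Separating a B

U : ℕ → Class
U m = SepRank true m

W : ℕ → Class
W m = SepRank false m

U∞ : Class
U∞ f = ∀ r → 2 ≤ r → SepRank true r f

W∞ : Class
W∞ f = ∀ r → 2 ≤ r → SepRank false r f

InInterval : Class → Class → Class → Set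
InInterval D₁ D₂ K = IsEquationalClass K × D₁ ⊆ K × K ⊆ D₂

CountableInterval : Class → Class → Set₁
CountableInterval D₁ D₂ =
  Σ (ℕ → Class) λ e → ∀ K → InInterval D₁ D₂ K → ∃ λ n → K ≐ e n

UncountableInterval : Class → Class → Set₁
UncountableInterval D₁ D₂ = ¬ CountableInterval D₁ D₂

-- Say an interval [D₁, D₂] admits a minor antichain if there are functions gₙ ∈ D₂ \ D₁
-- none of which is a minor of another. Then every S ⊆ ℕ yields the equational class
-- K_S = D₁ ∪ {minors of gₙ : n ∈ S} of the interval, and gₙ ∈ K_S exactly when n ∈ S; a
-- diagonal argument against any enumeration of the interval follows. For the antichain take,
-- on n + 3 variables, x₀ ∧ (|x| = 2) and x₀ ∧ (|x| ≠ 2) together with their duals: all are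
-- 1- (resp. 0-) separating of every rank because x₀ is fixed on their true (false) points, and
-- if one is a minor f(x ∘ σ) of another from the same family, evaluating at e₀ and at the
-- e₀ + eᵢ shows that σ has singleton fibres, so both have the same arity.
module Submission where

open import Defs
open import Data.Nat using (ℕ; zero; suc; _+_; _≤_; _≡ᵇ_; z≤n; s≤s)
open import Data.Nat.Properties using (≤-antisym; ≤-trans; ≤-reflexive; <-irrefl; m≤n+m; +-suc; suc-injective; +-cancelˡ-≡; ≡ᵇ⇒≡; ≡⇒≡ᵇ)
open import Data.Fin using (Fin; zero; suc)
open import Data.Fin.Properties using (_≟_; injective⇒≤)
open import Data.Bool using (Bool; true; false; not; _∧_; _∨_; if_then_else_; T) renaming (_≤_ to _≤ᵇ_)
open import Data.Bool using (b≤b; f≤t)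
open import Data.Bool.Properties using (not-injective; not-involutive; ∧-conicalˡ; ∧-conicalʳ; ≤-minimum; ≤-maximum)
open import Data.List using (map)
open import Data.List.Properties using (length-map)
open import Data.List.Relation.Unary.All as All using ()
open import Data.List.Relation.Unary.All.Properties using (map⁺; map⁻)
open import Data.Product using (∃; _×_; _,_; proj₁; proj₂)
open import Data.Sum using (_⊎_; inj₁; inj₂)
open import Data.Empty using (⊥-elim)
open import Function using (_∘_; id; const)
open import Relation.Nullary using (¬_; yes; no)
open import Relation.Binary.PropositionalEquality

infix 4 _≼_

data _≼_ : BFun → BFun → Set where
  minorVia : ∀ {k l} {f : Tuple k → Bool} {h : Tuple l → Bool} (σ : Fin (suc l) → Fin (suc k)) →
             (∀ x → f x ≡ h (x ∘ σ)) → (k , f) ≼ (l , h)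

≼-refl : ∀ {f} → f ≼ f
≼-refl = minorVia id λ _ → refl

≼-trans : ∀ {f g h} → f ≼ g → g ≼ h → f ≼ h
≼-trans (minorVia σ f≗gσ) (minorVia τ g≗hτ) = minorVia (σ ∘ τ) λ x → trans (f≗gσ x) (g≗hτ (x ∘ σ))

MinorClosed : Class → Set
MinorClosed K = ∀ {f h} → f ≼ h → K h → K f

minorClosed⇒equational : ∀ {K} → MinorClosed K → IsEquationalClass K
minorClosed⇒equational closed =
  (λ k f g f≗g → closed (minorVia id λ x → sym (f≗g x))) ,
  (λ k m f σ → closed (minorVia σ λ x → refl))

∩-minorClosed : ∀ {K L} → MinorClosed K → MinorClosed L → MinorClosed (K ∩ L)
∩-minorClosed K-closed L-closed f≼h (Kh , Lh) = K-closed f≼h Kh , L-closed f≼h Lh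

MinorAntichain : (ℕ → BFun) → Set
MinorAntichain g = ∀ {m n} → g m ≼ g n → m ≡ n

module Diagonal {D₁ D₂ : Class} (D₁-closed : MinorClosed D₁) (D₂-closed : MinorClosed D₂)
                (D₁⊆D₂ : D₁ ⊆ D₂) {g : ℕ → BFun} (g∈D₂ : ∀ n → D₂ (g n))
                (g∉D₁ : ∀ n → ¬ D₁ (g n)) (antichain : MinorAntichain g) where

  generatedBy : (ℕ → Set) → Class
  generatedBy S f = D₁ f ⊎ ∃ λ n → S n × f ≼ g n

  generatedBy-minorClosed : ∀ S → MinorClosed (generatedBy S)
  generatedBy-minorClosed S f≼h (inj₁ D₁h) = inj₁ (D₁-closed f≼h D₁h)
  generatedBy-minorClosed S f≼h (inj₂ (n , Sn , h≼gn)) = inj₂ (n , Sn , ≼-trans f≼h h≼gn)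

  generatedBy-inInterval : ∀ S → InInterval D₁ D₂ (generatedBy S)
  generatedBy-inInterval S =
    minorClosed⇒equational (generatedBy-minorClosed S) , (λ _ → inj₁) , ⊆D₂
    where
    ⊆D₂ : generatedBy S ⊆ D₂
    ⊆D₂ f (inj₁ D₁f) = D₁⊆D₂ f D₁f
    ⊆D₂ f (inj₂ (n , _ , f≼gn)) = D₂-closed f≼gn (g∈D₂ n)

  g∈generatedBy⇒∈ : ∀ {S n} → generatedBy S (g n) → S n
  g∈generatedBy⇒∈ {n = n} (inj₁ D₁gn) = ⊥-elim (g∉D₁ n D₁gn)
  g∈generatedBy⇒∈ {S} (inj₂ (m , Sm , gn≼gm)) = subst S (sym (antichain gn≼gm)) Sm

  uncountable : UncountableInterval D₁ D₂
  uncountable (e , enumerates)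
    with enumerates (generatedBy (λ n → ¬ e n (g n))) (generatedBy-inInterval _)
  ... | N , K⊆eN , eN⊆K = gN∉eN (K⊆eN (g N) (inj₂ (N , gN∉eN , ≼-refl)))
    where
    gN∉eN : ¬ e N (g N)
    gN∉eN gN∈eN = g∈generatedBy⇒∈ (eN⊆K (g N) gN∈eN) gN∈eN

uncountable-∩ : ∀ {C₁ C₂} → MinorClosed C₁ → MinorClosed C₂ → {g : ℕ → BFun} → MinorAntichain g →
                (∀ n → C₂ (g n)) → (∀ n → ¬ C₁ (g n)) → UncountableInterval (C₁ ∩ C₂) C₂
uncountable-∩ C₁-closed C₂-closed antichain g∈C₂ g∉C₁ =
  Diagonal.uncountable (∩-minorClosed C₁-closed C₂-closed) C₂-closed (λ _ → proj₂)
                       g∈C₂ (λ n → g∉C₁ n ∘ proj₁) antichain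

Tc-minorClosed : MinorClosed Tc
Tc-minorClosed (minorVia σ f≗hσ) (h0 , h1) = trans (f≗hσ _) h0 , trans (f≗hσ _) h1

Mon-minorClosed : MinorClosed Mon
Mon-minorClosed (minorVia σ f≗hσ) mon x y x≤y =
  subst₂ _≤ᵇ_ (sym (f≗hσ x)) (sym (f≗hσ y)) (mon (x ∘ σ) (y ∘ σ) (x≤y ∘ σ))

SepRank-minorClosed : ∀ a r → MinorClosed (SepRank a r)
SepRank-minorClosed a r (minorVia σ f≗hσ) sep B ∣B∣≤r fB≡a
  with sep (map (_∘ σ) B) (subst (_≤ r) (sym (length-map (_∘ σ) B)) ∣B∣≤r)
           (map⁺ (All.map (λ {b} → trans (sym (f≗hσ b))) fB≡a))
... | i , Bσ·i≡a = σ i , map⁻ Bσ·i≡a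

Mc-minorClosed : MinorClosed Mc
Mc-minorClosed = ∩-minorClosed Mon-minorClosed Tc-minorClosed

SepRank∞-minorClosed : ∀ a → MinorClosed (λ f → ∀ r → 2 ≤ r → SepRank a r f)
SepRank∞-minorClosed a f≼h sep r 2≤r = SepRank-minorClosed a r f≼h (sep r 2≤r)

fixedCoordinate⇒SepRank : ∀ {k} {f : Tuple k → Bool} a i → (∀ x → f x ≡ a → x i ≡ a) →
                          ∀ r → SepRank a r (k , f)
fixedCoordinate⇒SepRank a i fixed r B _ fB≡a = i , All.map (λ {b} → fixed b) fB≡a

dual : ∀ {k} → (Tuple k → Bool) → Tuple k → Bool
dual f x = not (f (not ∘ x))

Respects≗ : ∀ {k} → (Tuple k → Bool) → Set
Respects≗ f = ∀ {x y} → (∀ i → x i ≡ y i) → f x ≡ f y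

dual-≼ : ∀ {k l f h} → (k , f) ≼ (l , h) → (k , dual f) ≼ (l , dual h)
dual-≼ (minorVia σ f≗hσ) = minorVia σ λ x → cong not (f≗hσ (not ∘ x))

≼-dual-dual : ∀ {k} {f : Tuple k → Bool} → Respects≗ f → (k , f) ≼ (k , dual (dual f))
≼-dual-dual {f = f} resp = minorVia id λ x → begin
  f x                        ≡⟨ resp (λ i → sym (not-involutive (x i))) ⟩
  f (not ∘ not ∘ x)          ≡⟨ sym (not-involutive _) ⟩
  dual (dual f) x            ∎
  where open ≡-Reasoning

dual-dual-≼ : ∀ {k} {f : Tuple k → Bool} → Respects≗ f → (k , dual (dual f)) ≼ (k , f)
dual-dual-≼ {f = f} resp = minorVia id λ x → begin
  dual (dual f) x            ≡⟨ not-involutive _ ⟩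
  f (not ∘ not ∘ x)          ≡⟨ resp (λ i → not-involutive (x i)) ⟩
  f x                        ∎
  where open ≡-Reasoning

dual-reflects-≼ : ∀ {k l} {f : Tuple k → Bool} {h : Tuple l → Bool} → Respects≗ f → Respects≗ h →
                  (k , dual f) ≼ (l , dual h) → (k , f) ≼ (l , h)
dual-reflects-≼ f-resp h-resp f*≼h* =
  ≼-trans (≼-dual-dual f-resp) (≼-trans (dual-≼ f*≼h*) (dual-dual-≼ h-resp))

dual-Tc : ∀ {k f} → Tc (k , dual f) → Tc (k , f)
dual-Tc (f*0≡0 , f*1≡1) = not-injective {y = false} f*1≡1 , not-injective {y = true} f*0≡0

not-antitone : ∀ {a b} → a ≤ᵇ b → not b ≤ᵇ not a
not-antitone b≤b = b≤b
not-antitone f≤t = f≤t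

Mon-dual : ∀ {k f} → Mon (k , f) → Mon (k , dual f)
Mon-dual mon x y x≤y = not-antitone (mon (not ∘ y) (not ∘ x) (not-antitone ∘ x≤y))

dual-Mon : ∀ {k f} → Respects≗ f → Mon (k , dual f) → Mon (k , f)
dual-Mon resp = Mon-minorClosed (≼-dual-dual resp) ∘ Mon-dual

dual-fixedCoordinate : ∀ {k} {f : Tuple k → Bool} a i → (∀ x → f x ≡ a → x i ≡ a) →
                       ∀ x → dual f x ≡ not a → x i ≡ not a
dual-fixedCoordinate a i fixed x f*x≡¬a =
  trans (sym (not-involutive (x i))) (cong not (fixed (not ∘ x) (not-injective f*x≡¬a)))

⁅_⁆ : ∀ {n} → Fin n → Fin n → Bool
⁅ zero ⁆  zero    = true
⁅ zero ⁆  (suc _) = false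
⁅ suc _ ⁆ zero    = false
⁅ suc i ⁆ (suc j) = ⁅ i ⁆ j

⁅⁆-refl : ∀ {n} (i : Fin n) → ⁅ i ⁆ i ≡ true
⁅⁆-refl zero    = refl
⁅⁆-refl (suc i) = ⁅⁆-refl i

⁅⁆⇒≡ : ∀ {n} {i j : Fin n} → ⁅ i ⁆ j ≡ true → i ≡ j
⁅⁆⇒≡ {i = zero}  {zero}  _ = refl
⁅⁆⇒≡ {i = suc i} {suc j} e = cong suc (⁅⁆⇒≡ e)

⁅⁆-disjoint : ∀ {n} {i j : Fin n} → i ≢ j → ∀ k → ⁅ i ⁆ k ∧ ⁅ j ⁆ k ≡ false
⁅⁆-disjoint {i = i} {j} i≢j k with ⁅ i ⁆ k in i≡k | ⁅ j ⁆ k in j≡k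
... | true  | true  = ⊥-elim (i≢j (trans (⁅⁆⇒≡ i≡k) (sym (⁅⁆⇒≡ j≡k))))
... | true  | false = refl
... | false | _     = refl

infixr 6 _∪_

_∪_ : ∀ {n} → (Fin n → Bool) → (Fin n → Bool) → Fin n → Bool
(x ∪ y) i = x i ∨ y i

x≤ₜx∪y : ∀ {k} (x y : Tuple k) → x ≤ₜ (x ∪ y)
x≤ₜx∪y x y i with x i
... | true  = b≤b
... | false = ≤-minimum _

weight : ∀ {n} → (Fin n → Bool) → ℕ
weight {zero}  x = 0
weight {suc n} x = (if x zero then 1 else 0) + weight (x ∘ suc)

weight-cong : ∀ {n} {x y : Fin n → Bool} → (∀ i → x i ≡ y i) → weight x ≡ weight y
weight-cong {zero}  _   = refl
weight-cong {suc n} x≗y = cong₂ _+_ (cong (λ b → if b then 1 else 0) (x≗y zero)) (weight-cong (x≗y ∘ suc))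

weight-empty : ∀ n → weight {n} (const false) ≡ 0
weight-empty zero    = refl
weight-empty (suc n) = weight-empty n

weight-⁅⁆ : ∀ {n} (i : Fin n) → weight ⁅ i ⁆ ≡ 1
weight-⁅⁆ {suc n} zero = cong suc (weight-empty n)
weight-⁅⁆ (suc i)      = weight-⁅⁆ i

weight-∪ : ∀ {n} {x y : Fin n → Bool} → (∀ i → x i ∧ y i ≡ false) → weight (x ∪ y) ≡ weight x + weight y
weight-∪ {zero} _ = refl
weight-∪ {suc n} {x} {y} disjoint with x zero | y zero | disjoint zero
... | true  | false | _ = cong suc (weight-∪ (disjoint ∘ suc))
... | false | true  | _ = trans (cong suc (weight-∪ (disjoint ∘ suc))) (sym (+-suc _ _))
... | false | false | _ = weight-∪ (disjoint ∘ suc)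

weight-pos : ∀ {n} {x : Fin n → Bool} k → x k ≡ true → 1 ≤ weight x
weight-pos zero xk≡1 rewrite xk≡1 = s≤s z≤n
weight-pos (suc k) xk≡1 = ≤-trans (weight-pos k xk≡1) (m≤n+m _ _)

weight-two : ∀ {n} {x : Fin n → Bool} {k k'} → k ≢ k' → x k ≡ true → x k' ≡ true → 2 ≤ weight x
weight-two {k = zero}  {zero}   k≢k' _ _ = ⊥-elim (k≢k' refl)
weight-two {k = zero}  {suc k'} _ xk≡1 xk'≡1 rewrite xk≡1 = s≤s (weight-pos k' xk'≡1)
weight-two {k = suc k} {zero}   _ xk≡1 xk'≡1 rewrite xk'≡1 = s≤s (weight-pos k xk≡1)
weight-two {k = suc k} {suc k'} k≢k' xk≡1 xk'≡1 =
  ≤-trans (weight-two (k≢k' ∘ cong suc) xk≡1 xk'≡1) (m≤n+m _ _)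

weight-pos⇒∃ : ∀ {n} {x : Fin n → Bool} → 1 ≤ weight x → ∃ λ k → x k ≡ true
weight-pos⇒∃ {zero} ()
weight-pos⇒∃ {suc n} {x} 1≤w with x zero in x0≡1
... | true  = zero , x0≡1
... | false with k , xk≡1 ← weight-pos⇒∃ 1≤w = suc k , xk≡1

fibre : ∀ {m n} → (Fin m → Fin n) → Fin n → ℕ
fibre σ i = weight (⁅ i ⁆ ∘ σ)

singletonFibres⇒≡ : ∀ {m n} (σ : Fin m → Fin n) → (∀ i → fibre σ i ≡ 1) → m ≡ n
singletonFibres⇒≡ {m} {n} σ fibre≡1 = ≤-antisym (injective⇒≤ σ-injective) (injective⇒≤ section-injective)
  where
  σ-injective : ∀ {k k'} → σ k ≡ σ k' → k ≡ k'
  σ-injective {k} {k'} σk≡σk' with k ≟ k'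
  ... | yes k≡k' = k≡k'
  ... | no k≢k' = ⊥-elim (<-irrefl refl (subst (2 ≤_) (fibre≡1 (σ k)) 2≤fibre))
    where
    2≤fibre : 2 ≤ fibre σ (σ k)
    2≤fibre = weight-two k≢k' (⁅⁆-refl (σ k)) (subst (λ j → ⁅ σ k ⁆ j ≡ true) σk≡σk' (⁅⁆-refl (σ k)))
  preimage : ∀ i → ∃ λ k → ⁅ i ⁆ (σ k) ≡ true
  preimage i = weight-pos⇒∃ (≤-reflexive (sym (fibre≡1 i)))
  section-injective : ∀ {i i'} → proj₁ (preimage i) ≡ proj₁ (preimage i') → i ≡ i'
  section-injective {i} {i'} eq =
    trans (⁅⁆⇒≡ (proj₂ (preimage i))) (trans (cong σ eq) (sym (⁅⁆⇒≡ (proj₂ (preimage i')))))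

weight-pair∘ : ∀ {m n} (σ : Fin m → Fin n) {i j} → i ≢ j →
               weight ((⁅ i ⁆ ∪ ⁅ j ⁆) ∘ σ) ≡ fibre σ i + fibre σ j
weight-pair∘ σ i≢j = weight-∪ (⁅⁆-disjoint i≢j ∘ σ)

weight-pair : ∀ {n} {i j : Fin n} → i ≢ j → weight (⁅ i ⁆ ∪ ⁅ j ⁆) ≡ 2
weight-pair {i = i} {j} i≢j = trans (weight-pair∘ id i≢j) (cong₂ _+_ (weight-⁅⁆ i) (weight-⁅⁆ j))

sum≡2⇒both≡1 : ∀ {a b} → 1 ≤ a → a ≢ 2 → a + b ≡ 2 → a ≡ 1 × b ≡ 1
sum≡2⇒both≡1 {suc zero}          _ _   a+b≡2 = refl , suc-injective a+b≡2
sum≡2⇒both≡1 {suc (suc zero)}    _ a≢2 _     = ⊥-elim (a≢2 refl)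
sum≡2⇒both≡1 {suc (suc (suc a))} _ _   ()

fibres≡1 : ∀ {m n} (σ : Fin m → Fin (suc (suc n))) → 1 ≤ fibre σ zero → fibre σ zero ≢ 2 →
           (∀ i → i ≢ zero → fibre σ zero + fibre σ i ≡ 2) → ∀ i → fibre σ i ≡ 1
fibres≡1 σ pos ≢2 sum zero    = proj₁ (sum≡2⇒both≡1 pos ≢2 (sum (suc zero) λ ()))
fibres≡1 σ pos ≢2 sum (suc i) = proj₂ (sum≡2⇒both≡1 pos ≢2 (sum (suc i) λ ()))

-- Tuple k has suc k coordinates, so the n-th member has n + 3 variables.
family : (∀ {k} → Tuple k → Bool) → ℕ → BFun
family g n = 2 + n , g

singletonFibres⇒antichain : {g : ∀ {k} → Tuple k → Bool} →
  (∀ {k l} (σ : Fin (3 + l) → Fin (3 + k)) → (∀ x → g x ≡ g (x ∘ σ)) → ∀ i → fibre σ i ≡ 1) →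
  MinorAntichain (family g)
singletonFibres⇒antichain fibres (minorVia σ g≗gσ) =
  sym (+-cancelˡ-≡ 3 _ _ (singletonFibres⇒≡ σ (fibres σ g≗gσ)))

dual-antichain : {g : ∀ {k} → Tuple k → Bool} → (∀ {k} → Respects≗ (g {k})) →
                 MinorAntichain (family g) → MinorAntichain (family (dual g))
dual-antichain resp antichain g*≼g* = antichain (dual-reflects-≼ resp resp g*≼g*)

firstAndWeight : (ℕ → Bool) → ∀ {k} → Tuple k → Bool
firstAndWeight p x = x zero ∧ p (weight x)

firstAndWeight-respects≗ : ∀ p {k} → Respects≗ (firstAndWeight p {k})
firstAndWeight-respects≗ p x≗y = cong₂ (λ b c → b ∧ p c) (x≗y zero) (weight-cong x≗y)

firstAndWeight-fixed : ∀ p {k} (x : Tuple k) → firstAndWeight p x ≡ true → x zero ≡ true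
firstAndWeight-fixed p x = ∧-conicalˡ _ _

x₀∧∣x∣≡2 : ∀ {k} → Tuple k → Bool
x₀∧∣x∣≡2 = firstAndWeight (_≡ᵇ 2)

x₀∧∣x∣≢2 : ∀ {k} → Tuple k → Bool
x₀∧∣x∣≢2 = firstAndWeight (not ∘ (_≡ᵇ 2))

firstAndWeight-pair : ∀ p {k} {i : Fin (suc k)} → i ≢ zero → firstAndWeight p (⁅ zero ⁆ ∪ ⁅ i ⁆) ≡ p 2
firstAndWeight-pair p i≢0 = cong p (weight-pair (i≢0 ∘ sym))

firstAndWeight-⁅0⁆ : ∀ p {k} → firstAndWeight p {k} ⁅ zero ⁆ ≡ p 1
firstAndWeight-⁅0⁆ p {k} = cong p (weight-⁅⁆ {suc k} zero)

≡ᵇ2⇒≡2 : ∀ {c} → (c ≡ᵇ 2) ≡ true → c ≡ 2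
≡ᵇ2⇒≡2 {c} e = ≡ᵇ⇒≡ c 2 (subst T (sym e) _)

≡ᵇ2≡false⇒≢2 : ∀ {c} → (c ≡ᵇ 2) ≡ false → c ≢ 2
≡ᵇ2≡false⇒≢2 {c} e c≡2 = subst T e (≡⇒≡ᵇ c 2 c≡2)

firstAndWeight-x₀≡true : ∀ p {k} (x : Tuple k) → x zero ≡ true → firstAndWeight p x ≡ p (weight x)
firstAndWeight-x₀≡true p x x₀≡1 = cong (_∧ p (weight x)) x₀≡1

∈⁅0,1⁆∩⁅0,2⁆⇒≡0 : ∀ {n} {z : Fin (3 + n)} → (⁅ zero ⁆ ∪ ⁅ suc zero ⁆) z ≡ true →
                   (⁅ zero ⁆ ∪ ⁅ suc (suc zero) ⁆) z ≡ true → z ≡ zero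
∈⁅0,1⁆∩⁅0,2⁆⇒≡0 {z = zero}                _ _  = refl
∈⁅0,1⁆∩⁅0,2⁆⇒≡0 {z = suc zero}            _ ()
∈⁅0,1⁆∩⁅0,2⁆⇒≡0 {z = suc (suc zero)}      () _
∈⁅0,1⁆∩⁅0,2⁆⇒≡0 {z = suc (suc (suc _))}   () _

x₀∧∣x∣≡2-fibres : ∀ {k l} (σ : Fin (3 + l) → Fin (3 + k)) → (∀ x → x₀∧∣x∣≡2 x ≡ x₀∧∣x∣≡2 (x ∘ σ)) →
                  ∀ i → fibre σ i ≡ 1
x₀∧∣x∣≡2-fibres {k} σ g≗gσ = fibres≡1 σ (weight-pos {x = ⁅ zero ⁆ ∘ σ} zero 0∈σ⁻¹0) fibre0≢2 pairs
  where
  pair-true : ∀ i → i ≢ zero → x₀∧∣x∣≡2 ((⁅ zero ⁆ ∪ ⁅ i ⁆) ∘ σ) ≡ true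
  pair-true i i≢0 = trans (sym (g≗gσ (⁅ zero ⁆ ∪ ⁅ i ⁆))) (firstAndWeight-pair (_≡ᵇ 2) i≢0)
  0∈σ⁻¹0 : ⁅ zero ⁆ (σ zero) ≡ true
  0∈σ⁻¹0 = cong ⁅ zero ⁆ (∈⁅0,1⁆∩⁅0,2⁆⇒≡0 {z = σ zero} (∧-conicalˡ _ _ (pair-true (suc zero) λ ()))
                                             (∧-conicalˡ _ _ (pair-true (suc (suc zero)) λ ())))
  fibre0≢2 : fibre σ zero ≢ 2
  fibre0≢2 = ≡ᵇ2≡false⇒≢2 (begin
    fibre σ zero ≡ᵇ 2            ≡⟨ firstAndWeight-x₀≡true (_≡ᵇ 2) (⁅ zero ⁆ ∘ σ) 0∈σ⁻¹0 ⟨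
    x₀∧∣x∣≡2 (⁅ zero ⁆ ∘ σ)      ≡⟨ g≗gσ ⁅ zero ⁆ ⟨
    x₀∧∣x∣≡2 {2 + k} ⁅ zero ⁆   ≡⟨ firstAndWeight-⁅0⁆ (_≡ᵇ 2) {2 + k} ⟩
    false                        ∎)
    where open ≡-Reasoning
  pairs : ∀ i → i ≢ zero → fibre σ zero + fibre σ i ≡ 2
  pairs i i≢0 = trans (sym (weight-pair∘ σ (i≢0 ∘ sym))) (≡ᵇ2⇒≡2 (∧-conicalʳ _ _ (pair-true i i≢0)))

x₀∧∣x∣≢2-fibres : ∀ {k l} (σ : Fin (3 + l) → Fin (3 + k)) → (∀ x → x₀∧∣x∣≢2 x ≡ x₀∧∣x∣≢2 (x ∘ σ)) →
                  ∀ i → fibre σ i ≡ 1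
x₀∧∣x∣≢2-fibres {k} {l} σ g≗gσ = fibres≡1 σ (weight-pos {x = ⁅ zero ⁆ ∘ σ} zero 0∈σ⁻¹0) fibre0≢2 pairs
  where
  ⁅0⁆∘σ-true : x₀∧∣x∣≢2 (⁅ zero ⁆ ∘ σ) ≡ true
  ⁅0⁆∘σ-true = trans (sym (g≗gσ ⁅ zero ⁆)) (firstAndWeight-⁅0⁆ (not ∘ (_≡ᵇ 2)) {2 + k})
  0∈σ⁻¹0 : ⁅ zero ⁆ (σ zero) ≡ true
  0∈σ⁻¹0 = ∧-conicalˡ _ _ ⁅0⁆∘σ-true
  fibre0≢2 : fibre σ zero ≢ 2
  fibre0≢2 = ≡ᵇ2≡false⇒≢2 (not-injective {y = false} (∧-conicalʳ _ _ ⁅0⁆∘σ-true))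
  pairs : ∀ i → i ≢ zero → fibre σ zero + fibre σ i ≡ 2
  pairs i i≢0 = trans (sym (weight-pair∘ σ (i≢0 ∘ sym))) (≡ᵇ2⇒≡2 (not-injective {y = true} (begin
    not (weight pair∘σ ≡ᵇ 2)       ≡⟨ firstAndWeight-x₀≡true (not ∘ (_≡ᵇ 2)) pair∘σ
                                        (cong (_∨ ⁅ i ⁆ (σ zero)) 0∈σ⁻¹0) ⟨
    x₀∧∣x∣≢2 pair∘σ               ≡⟨ g≗gσ (⁅ zero ⁆ ∪ ⁅ i ⁆) ⟨
    x₀∧∣x∣≢2 (⁅ zero ⁆ ∪ ⁅ i ⁆)   ≡⟨ firstAndWeight-pair (not ∘ (_≡ᵇ 2)) i≢0 ⟩
    false                         ∎)))
    where
    open ≡-Reasoning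
    pair∘σ : Tuple (2 + l)
    pair∘σ = (⁅ zero ⁆ ∪ ⁅ i ⁆) ∘ σ

x₀∧∣x∣≡2-antichain : MinorAntichain (family x₀∧∣x∣≡2)
x₀∧∣x∣≡2-antichain = singletonFibres⇒antichain {x₀∧∣x∣≡2} x₀∧∣x∣≡2-fibres

x₀∧∣x∣≢2-antichain : MinorAntichain (family x₀∧∣x∣≢2)
x₀∧∣x∣≢2-antichain = singletonFibres⇒antichain {x₀∧∣x∣≢2} x₀∧∣x∣≢2-fibres

-- On n + 3 variables the all-true tuple has weight 3 + _, which _≡ᵇ 2 decides by computation.
x₀∧∣x∣≡2∉Tc : ∀ n → ¬ Tc (family x₀∧∣x∣≡2 n)
x₀∧∣x∣≡2∉Tc n (_ , ())

x₀∧∣x∣≡2∉Mon : ∀ n → ¬ Mon (family x₀∧∣x∣≡2 n)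
x₀∧∣x∣≡2∉Mon n mon
  with subst (_≤ᵇ false) (firstAndWeight-pair (_≡ᵇ 2) {2 + n} {suc zero} λ ())
             (mon (⁅ zero ⁆ ∪ ⁅ suc zero ⁆) (const true) (λ _ → ≤-maximum _))
... | ()

x₀∧∣x∣≢2∈Tc : ∀ n → Tc (family x₀∧∣x∣≢2 n)
x₀∧∣x∣≢2∈Tc n = refl , refl

x₀∧∣x∣≢2∉Mon : ∀ n → ¬ Mon (family x₀∧∣x∣≢2 n)
x₀∧∣x∣≢2∉Mon n mon
  with subst₂ _≤ᵇ_ (firstAndWeight-⁅0⁆ (not ∘ (_≡ᵇ 2)) {2 + n})
                   (firstAndWeight-pair (not ∘ (_≡ᵇ 2)) {2 + n} {suc zero} λ ())
             (mon ⁅ zero ⁆ (⁅ zero ⁆ ∪ ⁅ suc zero ⁆) (x≤ₜx∪y ⁅ zero ⁆ ⁅ suc zero ⁆))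
... | ()

x₀∧∣x∣≡2∈U : ∀ r n → U r (family x₀∧∣x∣≡2 n)
x₀∧∣x∣≡2∈U r n = fixedCoordinate⇒SepRank true zero (firstAndWeight-fixed (_≡ᵇ 2)) r

x₀∧∣x∣≢2∈U : ∀ r n → U r (family x₀∧∣x∣≢2 n)
x₀∧∣x∣≢2∈U r n = fixedCoordinate⇒SepRank true zero (firstAndWeight-fixed (not ∘ (_≡ᵇ 2))) r

dual-x₀∧∣x∣≡2∈W : ∀ r n → W r (family (dual x₀∧∣x∣≡2) n)
dual-x₀∧∣x∣≡2∈W r n =
  fixedCoordinate⇒SepRank false zero (dual-fixedCoordinate true zero (firstAndWeight-fixed (_≡ᵇ 2))) r

dual-x₀∧∣x∣≢2∈W : ∀ r n → W r (family (dual x₀∧∣x∣≢2) n)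
dual-x₀∧∣x∣≢2∈W r n =
  fixedCoordinate⇒SepRank false zero (dual-fixedCoordinate true zero (firstAndWeight-fixed (not ∘ (_≡ᵇ 2)))) r

dual-x₀∧∣x∣≡2-antichain : MinorAntichain (family (dual x₀∧∣x∣≡2))
dual-x₀∧∣x∣≡2-antichain = dual-antichain (firstAndWeight-respects≗ (_≡ᵇ 2)) x₀∧∣x∣≡2-antichain

dual-x₀∧∣x∣≢2-antichain : MinorAntichain (family (dual x₀∧∣x∣≢2))
dual-x₀∧∣x∣≢2-antichain = dual-antichain (firstAndWeight-respects≗ (not ∘ (_≡ᵇ 2))) x₀∧∣x∣≢2-antichain

dual-x₀∧∣x∣≡2∉Tc : ∀ n → ¬ Tc (family (dual x₀∧∣x∣≡2) n)
dual-x₀∧∣x∣≡2∉Tc n = x₀∧∣x∣≡2∉Tc n ∘ dual-Tc {2 + n} {x₀∧∣x∣≡2}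

dual-x₀∧∣x∣≡2∉Mon : ∀ n → ¬ Mon (family (dual x₀∧∣x∣≡2) n)
dual-x₀∧∣x∣≡2∉Mon n = x₀∧∣x∣≡2∉Mon n ∘ dual-Mon (firstAndWeight-respects≗ (_≡ᵇ 2))

dual-x₀∧∣x∣≢2∈Tc : ∀ n → Tc (family (dual x₀∧∣x∣≢2) n)
dual-x₀∧∣x∣≢2∈Tc n = refl , refl

dual-x₀∧∣x∣≢2∉Mon : ∀ n → ¬ Mon (family (dual x₀∧∣x∣≢2) n)
dual-x₀∧∣x∣≢2∉Mon n = x₀∧∣x∣≢2∉Mon n ∘ dual-Mon (firstAndWeight-respects≗ (not ∘ (_≡ᵇ 2)))

proposition6 :
    (∀ m → 2 ≤ m → UncountableInterval (Tc ∩ U m) (U m)) ×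
    UncountableInterval (Tc ∩ U∞) U∞ ×
    (∀ m → 2 ≤ m → UncountableInterval (Mon ∩ U m) (U m)) ×
    UncountableInterval (Mon ∩ U∞) U∞ ×
    (∀ m → 2 ≤ m → UncountableInterval (Tc ∩ W m) (W m)) ×
    UncountableInterval (Tc ∩ W∞) W∞ ×
    (∀ m → 2 ≤ m → UncountableInterval (Mon ∩ W m) (W m)) ×
    UncountableInterval (Mon ∩ W∞) W∞ ×
    (∀ m → 2 ≤ m → UncountableInterval (Mc ∩ (Tc ∩ U m)) (Tc ∩ U m)) ×
    UncountableInterval (Mc ∩ (Tc ∩ U∞)) (Tc ∩ U∞) ×
    (∀ m → 2 ≤ m → UncountableInterval (Mc ∩ (Tc ∩ W m)) (Tc ∩ W m)) ×
    UncountableInterval (Mc ∩ (Tc ∩ W∞)) (Tc ∩ W∞)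
proposition6 =
  (λ m _ → uncountable-∩ Tc-minorClosed (SepRank-minorClosed true m) x₀∧∣x∣≡2-antichain
             (x₀∧∣x∣≡2∈U m) x₀∧∣x∣≡2∉Tc) ,
  uncountable-∩ Tc-minorClosed (SepRank∞-minorClosed true) x₀∧∣x∣≡2-antichain
    (λ n r _ → x₀∧∣x∣≡2∈U r n) x₀∧∣x∣≡2∉Tc ,
  (λ m _ → uncountable-∩ Mon-minorClosed (SepRank-minorClosed true m) x₀∧∣x∣≡2-antichain
             (x₀∧∣x∣≡2∈U m) x₀∧∣x∣≡2∉Mon) ,
  uncountable-∩ Mon-minorClosed (SepRank∞-minorClosed true) x₀∧∣x∣≡2-antichain
    (λ n r _ → x₀∧∣x∣≡2∈U r n) x₀∧∣x∣≡2∉Mon ,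
  (λ m _ → uncountable-∩ Tc-minorClosed (SepRank-minorClosed false m) dual-x₀∧∣x∣≡2-antichain
             (dual-x₀∧∣x∣≡2∈W m) dual-x₀∧∣x∣≡2∉Tc) ,
  uncountable-∩ Tc-minorClosed (SepRank∞-minorClosed false) dual-x₀∧∣x∣≡2-antichain
    (λ n r _ → dual-x₀∧∣x∣≡2∈W r n) dual-x₀∧∣x∣≡2∉Tc ,
  (λ m _ → uncountable-∩ Mon-minorClosed (SepRank-minorClosed false m) dual-x₀∧∣x∣≡2-antichain
             (dual-x₀∧∣x∣≡2∈W m) dual-x₀∧∣x∣≡2∉Mon) ,
  uncountable-∩ Mon-minorClosed (SepRank∞-minorClosed false) dual-x₀∧∣x∣≡2-antichain
    (λ n r _ → dual-x₀∧∣x∣≡2∈W r n) dual-x₀∧∣x∣≡2∉Mon ,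
  (λ m _ → uncountable-∩ Mc-minorClosed (∩-minorClosed Tc-minorClosed (SepRank-minorClosed true m))
             x₀∧∣x∣≢2-antichain (λ n → x₀∧∣x∣≢2∈Tc n , x₀∧∣x∣≢2∈U m n) (λ n → x₀∧∣x∣≢2∉Mon n ∘ proj₁)) ,
  uncountable-∩ Mc-minorClosed (∩-minorClosed Tc-minorClosed (SepRank∞-minorClosed true))
    x₀∧∣x∣≢2-antichain (λ n → x₀∧∣x∣≢2∈Tc n , λ r _ → x₀∧∣x∣≢2∈U r n) (λ n → x₀∧∣x∣≢2∉Mon n ∘ proj₁) ,
  (λ m _ → uncountable-∩ Mc-minorClosed (∩-minorClosed Tc-minorClosed (SepRank-minorClosed false m))
             dual-x₀∧∣x∣≢2-antichain (λ n → dual-x₀∧∣x∣≢2∈Tc n , dual-x₀∧∣x∣≢2∈W m n)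
             (λ n → dual-x₀∧∣x∣≢2∉Mon n ∘ proj₁)) ,
  uncountable-∩ Mc-minorClosed (∩-minorClosed Tc-minorClosed (SepRank∞-minorClosed false))
    dual-x₀∧∣x∣≢2-antichain (λ n → dual-x₀∧∣x∣≢2∈Tc n , λ r _ → dual-x₀∧∣x∣≢2∈W r n)
    (λ n → dual-x₀∧∣x∣≢2∉Mon n ∘ proj₁)
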